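{- If $n, m \geq 2$, then $c_H(K_n \square K_m) \leq 4$.
   Context: $K_n$ is the complete graph on $n$ vertices. The Cartesian product $G \square J$ has vertex set $V(G) \times V(J)$, with $(x,y)$ adjacent to $(x',y')$ iff either $x = x'$ and $yy' \in E(J)$, or $y = y'$ and $xx' \in E(G)$. Hyperopic Cops and Robber on a graph $H$ (each vertex considered to carry a loop, so a player may stay put): the cops first occupy a multiset of vertices, then the robber chooses a vertex. In each round, each cop moves to an adjacent vertex or stays, then the robber moves to an adjacent vertex or stays. The robber always sees all cops. The cops see the robber's position except when the robber's vertex is adjacent to every vertex occupied by a cop, in which case the robber is invisible. The robber is captured when a cop occupies the robber's vertex. $c_H(H)$ is the minimum number of cops that can guarantee capture in finitely many moves. -}

module Defs where

open import Data.Nat using (ℕ; zero; suc; _≤_)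
open import Data.Fin using (Fin)
open import Data.Fin.Properties using () renaming (_≟_ to _≟F_)
open import Data.Product using (Σ; ∃; ∃-syntax; _×_; _,_; proj₁; proj₂)
open import Data.Product.Properties using (≡-dec)
open import Data.Sum using (_⊎_; inj₁; inj₂)
open import Data.Maybe using (Maybe; just; nothing)
open import Data.List using (List; []; _∷_)
open import Data.Vec using (Vec; lookup)
open import Data.Vec.Relation.Unary.All using (All; all?)
open import Relation.Nullary using (¬_; Dec; yes; no)
open import Relation.Nullary.Decidable using (_⊎-dec_; _×-dec_; ¬?)
open import Relation.Binary.PropositionalEquality using (_≡_; _≢_)
open import Relation.Binary using (Decidable)

KVertex : ℕ → ℕ → Set
KVertex n m = Fin n × Fin m

KAdj : ∀ {n} → Fin n → Fin n → Set
KAdj x x' = x ≢ x'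

BoxAdj : ∀ {n m} → KVertex n m → KVertex n m → Set
BoxAdj (x , y) (x' , y') = (x ≡ x' × KAdj y y') ⊎ (y ≡ y' × KAdj x x')

-- Adjacency with a loop at every vertex (the relation used in the game)
ClosedAdj : ∀ {n m} → KVertex n m → KVertex n m → Set
ClosedAdj u v = (u ≡ v) ⊎ BoxAdj u v

closedAdj? : ∀ {n m} → Decidable (ClosedAdj {n} {m})
closedAdj? (x , y) (x' , y') =
  ≡-dec _≟F_ _≟F_ (x , y) (x' , y')
    ⊎-dec (((x ≟F x') ×-dec ¬? (y ≟F y')) ⊎-dec ((y ≟F y') ×-dec ¬? (x ≟F x')))

module Hyperopic {V : Set} (Adj : V → V → Set) (adj? : Decidable Adj) (k : ℕ) where

  -- What the cops observe of the robber: `just r` if the robber at r is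
  -- visible, `nothing` if the robber is adjacent to every occupied vertex.
  view : Vec V k → V → Maybe V
  view cops r with all? (λ c → adj? r c) cops
  ... | yes _ = nothing
  ... | no  _ = just r

  -- A cop strategy: an initial placement, and a move rule which depends
  -- only on the cops' own current positions and the history of
  -- observations of the robber (most recent first).
  record CopStrategy : Set where
    field
      start : Vec V k
      move  : List (Maybe V) → Vec V k → Vec V k
      legal : ∀ h c i → Adj (lookup c i) (lookup (move h c) i)

  open CopStrategy

  -- Round 0: cops placed, robber placed at r 0, observation made.
  -- Round t+1: cops move, then robber moves to r (t+1), observation made.
  play : CopStrategy → (ℕ → V) → ℕ → Vec V k × List (Maybe V)
  play σ r zero = start σ , view (start σ) (r zero) ∷ []
  play σ r (suc t) with play σ r t
  ... | c , h = move σ h c , view (move σ h c) (r (suc t)) ∷ h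

  copsAt : CopStrategy → (ℕ → V) → ℕ → Vec V k
  copsAt σ r t = proj₁ (play σ r t)

  RobberWalk : (ℕ → V) → Set
  RobberWalk r = ∀ t → Adj (r t) (r (suc t))

  -- Robber (at r t after round t) is captured at round t, either because a
  -- cop sits on r t after round t, or a cop moves onto r t in round t+1.
  CaughtAt : CopStrategy → (ℕ → V) → ℕ → Set
  CaughtAt σ r t =
    (∃[ i ] lookup (copsAt σ r t) i ≡ r t) ⊎
    (∃[ i ] lookup (copsAt σ r (suc t)) i ≡ r t)

  CopsWin : Set
  CopsWin = Σ CopStrategy λ σ → Σ ℕ λ N →
    ∀ (r : ℕ → V) → RobberWalk r → ∃[ t ] (t ≤ N × CaughtAt σ r t)

HyperopicCopNumber≤ : {V : Set} (Adj : V → V → Set) → Decidable Adj → ℕ → Set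
HyperopicCopNumber≤ Adj adj? c = ∃[ k ] (k ≤ c × Hyperopic.CopsWin Adj adj? k)

-- Two cops suffice.  Put them on opposite corners (a₀ , b₀) and (a₁ , b₁) of a
-- rectangle.  The robber is invisible only on the other two corners, which
-- the cops then step onto.  A visible robber adjacent to a cop is caught at
-- once; otherwise the cops move onto the two lines through the robber,
-- (x , b₀) and (a₁ , y), so that every vertex the robber can reach is seen
-- and adjacent to a cop, except (x , y) itself, where it is invisible but
-- pinned: the only common neighbours of the two cops are (x , y) and
-- (a₁ , b₀), and the latter is out of the robber's reach.
module Submission where

open import Defs
open import Data.Nat using (ℕ; _≤_; z≤n; s≤s)
open import Data.Fin using (Fin; zero; suc)
open import Data.Fin.Properties using (_≟_; any?)
open import Data.Product using (∃-syntax; _×_; _,_)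
open import Data.Sum using (_⊎_; inj₁; inj₂; [_,_]′; map₂)
open import Data.Maybe using (Maybe; just; nothing; fromMaybe)
open import Data.List using (List; []; _∷_; head; catMaybes)
open import Data.Vec using (Vec; []; _∷_; lookup; tabulate)
open import Data.Vec.Properties using (lookup∘tabulate; tabulate-cong)
open import Data.Vec.Relation.Unary.All using (All; []; _∷_; all?)
open import Data.Empty using (⊥-elim)
open import Relation.Nullary using (¬_; yes; no)
open import Relation.Binary using (Decidable)
open import Relation.Binary.PropositionalEquality
  using (_≡_; _≢_; refl; sym; trans; subst; ≢-sym)

module Observation {V : Set} (Adj : V → V → Set) (adj? : Decidable Adj) {k : ℕ} where
  open Hyperopic Adj adj? k

  Occupied : Vec V k → V → Set
  Occupied C v = ∃[ i ] lookup C i ≡ v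

  data Sighting (C : Vec V k) (r : V) : Maybe V → Set where
    unseen : All (λ c → Adj r c) C → Sighting C r nothing
    seen   : Sighting C r (just r)

  sighting : ∀ C r → Sighting C r (view C r)
  sighting C r with all? (λ c → adj? r c) C
  ... | yes r~C = unseen r~C
  ... | no  _   = seen

module _ {n m : ℕ} where

  closedAdj⇒shareCoord : ∀ {x x' : Fin n} {y y' : Fin m} →
                         ClosedAdj (x , y) (x' , y') → x ≡ x' ⊎ y ≡ y'
  closedAdj⇒shareCoord (inj₁ refl)             = inj₁ refl
  closedAdj⇒shareCoord (inj₂ (inj₁ (x≡x' , _))) = inj₁ x≡x'
  closedAdj⇒shareCoord (inj₂ (inj₂ (y≡y' , _))) = inj₂ y≡y'

  shareCoord⇒closedAdj : ∀ {x x' : Fin n} {y y' : Fin m} →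
                         x ≡ x' ⊎ y ≡ y' → ClosedAdj (x , y) (x' , y')
  shareCoord⇒closedAdj {y = y} {y'} (inj₁ refl) with y ≟ y'
  ... | yes refl = inj₁ refl
  ... | no  y≢y' = inj₂ (inj₁ (refl , y≢y'))
  shareCoord⇒closedAdj {x = x} {x'} (inj₂ refl) with x ≟ x'
  ... | yes refl = inj₁ refl
  ... | no  x≢x' = inj₂ (inj₂ (refl , x≢x'))

  closedAdj-sameFst : ∀ {x : Fin n} {y y' : Fin m} → ClosedAdj (x , y) (x , y')
  closedAdj-sameFst = shareCoord⇒closedAdj (inj₁ refl)

  closedAdj-sameSnd : ∀ {x x' : Fin n} {y : Fin m} → ClosedAdj (x , y) (x' , y)
  closedAdj-sameSnd = shareCoord⇒closedAdj (inj₂ refl)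

  distinctCoords⇒¬closedAdj : ∀ {x x' : Fin n} {y y' : Fin m} →
                              x ≢ x' → y ≢ y' → ¬ ClosedAdj (x , y) (x' , y')
  distinctCoords⇒¬closedAdj x≢x' y≢y' adj with closedAdj⇒shareCoord adj
  ... | inj₁ x≡x' = x≢x' x≡x'
  ... | inj₂ y≡y' = y≢y' y≡y'

  closedAdj-oppositeCorners : ∀ {x x' : Fin n} {y y' : Fin m} {v : KVertex n m} →
    x ≢ x' → y ≢ y' → ClosedAdj v (x , y) → ClosedAdj v (x' , y') →
    v ≡ (x , y') ⊎ v ≡ (x' , y)
  closedAdj-oppositeCorners {v = p , q} x≢x' y≢y' v~xy v~x'y'
    with closedAdj⇒shareCoord v~xy | closedAdj⇒shareCoord v~x'y'
  ... | inj₁ refl | inj₁ refl = ⊥-elim (x≢x' refl)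
  ... | inj₁ refl | inj₂ refl = inj₁ refl
  ... | inj₂ refl | inj₁ refl = inj₂ refl
  ... | inj₂ refl | inj₂ refl = ⊥-elim (y≢y' refl)

module TwoCops {n m : ℕ} {a₀ a₁ : Fin n} {b₀ b₁ : Fin m}
               (a₀≢a₁ : a₀ ≢ a₁) (b₀≢b₁ : b₀ ≢ b₁) where

  V : Set
  V = KVertex n m

  open Hyperopic (ClosedAdj {n} {m}) closedAdj? 2
  open Observation (ClosedAdj {n} {m}) closedAdj? {2}

  start : Vec V 2
  start = (a₀ , b₀) ∷ (a₁ , b₁) ∷ []

  home : Fin 2 → V
  home zero       = (a₀ , b₁)
  home (suc zero) = (a₁ , b₀)

  lineUp : Fin 2 → V → V → V
  lineUp zero       (_ , y) (x' , _) = (x' , y)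
  lineUp (suc zero) (x , _) (_ , y') = (x , y')

  lineUp-adj : ∀ i c v → ClosedAdj c (lineUp i c v)
  lineUp-adj zero       _ _ = closedAdj-sameSnd
  lineUp-adj (suc zero) _ _ = closedAdj-sameFst

  target : Fin 2 → List (Maybe V) → V
  target i h = fromMaybe (home i) (head (catMaybes h))

  approach : Fin 2 → V → V → V
  approach i c v with closedAdj? c v
  ... | yes _ = v
  ... | no  _ = lineUp i c v

  approach-adj : ∀ i c v → ClosedAdj c (approach i c v)
  approach-adj i c v with closedAdj? c v
  ... | yes c~v = c~v
  ... | no  _   = lineUp-adj i c v

  approach-reaches : ∀ {i c v} → ClosedAdj c v → approach i c v ≡ v
  approach-reaches {i} {c} {v} c~v with closedAdj? c v
  ... | yes _   = refl
  ... | no  c≁v = ⊥-elim (c≁v c~v)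

  approach-lineUp : ∀ {i c v} → ¬ ClosedAdj c v → approach i c v ≡ lineUp i c v
  approach-lineUp {i} {c} {v} c≁v with closedAdj? c v
  ... | yes c~v = ⊥-elim (c≁v c~v)
  ... | no  _   = refl

  -- Abstract, so that checking capturedWithinTwoRounds does not unfold the
  -- cops' decisions inside the play.
  abstract
    moves : List (Maybe V) → Vec V 2 → Vec V 2
    moves h C = tabulate λ i → approach i (lookup C i) (target i h)

    lookup-moves : ∀ h C i → lookup (moves h C) i ≡ approach i (lookup C i) (target i h)
    lookup-moves h C i = lookup∘tabulate (λ j → approach j (lookup C j) (target j h)) i

    moves-lineUp : ∀ h C {r} → (∀ i → ¬ ClosedAdj (lookup C i) r) →
                   moves (just r ∷ h) C ≡ tabulate (λ i → lineUp i (lookup C i) r)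
    moves-lineUp h C C≁r = tabulate-cong λ i → approach-lineUp {i} (C≁r i)

  σ : CopStrategy
  σ = record
    { start = start
    ; move  = moves
    ; legal = λ h C i → subst (ClosedAdj (lookup C i)) (sym (lookup-moves h C i))
                               (approach-adj i (lookup C i) (target i h))
    }

  captures-target : ∀ h C i → ClosedAdj (lookup C i) (target i h) →
                    Occupied (moves h C) (target i h)
  captures-target h C i c~t = i , trans (lookup-moves h C i) (approach-reaches c~t)

  data Pincer : Vec V 2 → V → Set where
    pincer : ∀ {x x' y y'} → x ≢ x' → y ≢ y' → Pincer ((x , y') ∷ (x' , y) ∷ []) (x , y)

  firstRound : ∀ {r₀ o} → Sighting start r₀ o →
    let C₁ = moves (o ∷ []) start in
    Occupied C₁ r₀ ⊎ (o ≡ just r₀ × Pincer C₁ r₀)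
  firstRound {o = o} (unseen (r₀~c₀ ∷ r₀~c₁ ∷ []))
    with closedAdj-oppositeCorners a₀≢a₁ b₀≢b₁ r₀~c₀ r₀~c₁
  ... | inj₁ refl = inj₁ (captures-target (o ∷ []) start zero closedAdj-sameFst)
  ... | inj₂ refl = inj₁ (captures-target (o ∷ []) start (suc zero) closedAdj-sameFst)
  firstRound {r₀ = x , y} seen with any? (λ i → closedAdj? (lookup start i) (x , y))
  ... | yes (i , c~r₀) = inj₁ (captures-target (just (x , y) ∷ []) start i c~r₀)
  ... | no  none       =
    inj₂ (refl , subst (λ C → Pincer C (x , y))
                       (sym (moves-lineUp [] start λ i c~r₀ → none (i , c~r₀)))
                       (pincer (λ { refl → none (suc zero , closedAdj-sameFst) })
                               (λ { refl → none (zero , closedAdj-sameSnd) })))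

  pincerCaptures : ∀ {C r₀ r₁ o} →
    Pincer C r₀ → ClosedAdj r₀ r₁ → Sighting C r₁ o →
    Occupied (moves (o ∷ just r₀ ∷ []) C) r₁
  pincerCaptures {C} {o = o} (pincer x≢x' y≢y') r₀~r₁ (unseen (r₁~c₀ ∷ r₁~c₁ ∷ []))
    with closedAdj-oppositeCorners x≢x' (≢-sym y≢y') r₁~c₀ r₁~c₁
  ... | inj₁ refl = captures-target (o ∷ just _ ∷ []) C zero closedAdj-sameFst
  ... | inj₂ refl = ⊥-elim (distinctCoords⇒¬closedAdj x≢x' y≢y' r₀~r₁)
  pincerCaptures {C} {r₀} {_ , _} (pincer _ _) r₀~r₁ seen with closedAdj⇒shareCoord r₀~r₁
  ... | inj₁ refl = captures-target (just _ ∷ just r₀ ∷ []) C zero closedAdj-sameFst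
  ... | inj₂ refl = captures-target (just _ ∷ just r₀ ∷ []) C (suc zero) closedAdj-sameSnd

  twoRounds : ∀ {r₀ r₁ o} → ClosedAdj r₀ r₁ → Sighting start r₀ o →
    let C₁ = moves (o ∷ []) start in
    Occupied C₁ r₀ ⊎ Occupied (moves (view C₁ r₁ ∷ o ∷ []) C₁) r₁
  twoRounds {r₁ = r₁} r₀~r₁ s =
    map₂ (λ { (refl , pinned) → pincerCaptures pinned r₀~r₁ (sighting _ r₁) }) (firstRound s)

  capturedWithinTwoRounds : ∀ r → RobberWalk r → ∃[ t ] (t ≤ 1 × CaughtAt σ r t)
  capturedWithinTwoRounds r walk =
    [ (λ caught → 0 , z≤n , inj₂ caught)
    , (λ caught → 1 , s≤s z≤n , inj₂ caught)
    ]′ (twoRounds (walk 0) (sighting start (r 0)))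

  copsWin : CopsWin
  copsWin = σ , 1 , capturedWithinTwoRounds

theorem5p2 : (n m : ℕ) → 2 ≤ n → 2 ≤ m →
    HyperopicCopNumber≤ (ClosedAdj {n} {m}) closedAdj? 4
theorem5p2 _ _ (s≤s (s≤s _)) (s≤s (s≤s _)) =
  2 , s≤s (s≤s z≤n) ,
  TwoCops.copsWin {a₀ = zero} {a₁ = suc zero} {b₀ = zero} {b₁ = suc zero} (λ ()) (λ ())
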